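{- Let $x,y,u,v,a$ be positive integers with $|xu-yv|\le a$. Then $\mathrm{dist}\big((x,y),T_{0,\max(u,v)}\big)\le a(u+v)$.
   Context: For a real number $\alpha\ge1$, $T_{0,\alpha}$ is the set of pairs $(c,d)$ of positive integers such that $\gcd(c,d)\ge \frac{\max(c,d)}{\alpha}$. For points $p=(x,y)$, $p'=(x',y')$, $\mathrm{dist}(p,p')=|x-x'|+|y-y'|$ (the $1$-norm distance), and for a set $\mathcal D$ of points, $\mathrm{dist}(p,\mathcal D)=\min\{\mathrm{dist}(p,p''):p''\in\mathcal D\}$. -}

module Defs where

open import Data.Nat.Base using (ℕ; _+_; _*_; _<_; _≤_; _⊔_; ∣_-_∣)
open import Data.Nat.GCD using (gcd)
open import Data.Product using (_×_; ∃₂)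

-- Membership of (c , d) in T_{0,α} for an integer parameter α ≥ 1:
-- c, d positive and gcd(c,d) ≥ max(c,d)/α, i.e. (multiplying by α > 0)
-- max(c,d) ≤ α · gcd(c,d).
InT0 : ℕ → ℕ → ℕ → Set
InT0 α c d = 0 < c × 0 < d × (c ⊔ d) ≤ α * gcd c d

dist : ℕ → ℕ → ℕ → ℕ → ℕ
dist x y c d = ∣ x - c ∣ + ∣ y - d ∣

-- dist((x,y), T_{0,α}) ≤ B.  The distance is a minimum over a nonempty set
-- of naturals, so it is attained; hence "min ≤ B" means some point of T
-- is within distance B.
DistT0≤ : ℕ → ℕ → ℕ → ℕ → Set
DistT0≤ α x y B = ∃₂ λ c d → InT0 α c d × dist x y c d ≤ B

module Submission where

open import Defs
open import Data.Nat.Base using (ℕ; _+_; _*_; _<_; _≤_; _⊔_; ∣_-_∣; suc; _∸_; z<s; s≤s; _/_; _%_; NonZero; >-nonZero; ≢-nonZero)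
open import Data.Nat.Properties
open import Data.Nat.DivMod using (m≡m%n+[m/n]*n; m%n<n)
open import Data.Nat.Divisibility using (∣⇒≤; m∣m*n)
open import Data.Nat.GCD using (gcd; gcd-greatest; gcd[m,n]≢0)
open import Data.Nat.Tactic.RingSolver using (solve-∀)
open import Data.Product using (_×_; _,_; ∃₂)
open import Data.Sum using (inj₁)
open import Relation.Binary.PropositionalEquality

-- The witness is (k v , k u) with k v the least multiple of v that is ≥ x.
-- Being a multiple of (v , u) puts it in T_{0,max(u,v)}; its first coordinate
-- is off by D < v, and then |x u - y v| ≤ a forces |y - k u| v ≤ a + D u.

*-∈T0 : ∀ {α} k c d → 0 < k → 0 < c → 0 < d → c ⊔ d ≤ α → InT0 α (k * c) (k * d)
*-∈T0 {α} k c d 0<k 0<c 0<d c⊔d≤α =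
  0<kc , *-mono-< 0<k 0<d , (begin
    k * c ⊔ k * d ≡⟨ *-distribˡ-⊔ k c d ⟨
    k * (c ⊔ d)   ≤⟨ *-mono-≤ k≤g c⊔d≤α ⟩
    g * α         ≡⟨ *-comm g α ⟩
    α * g         ∎)
  where
  open ≤-Reasoning
  0<kc : 0 < k * c
  0<kc = *-mono-< 0<k 0<c
  g : ℕ
  g = gcd (k * c) (k * d)
  instance
    g≢0 : NonZero g
    g≢0 = ≢-nonZero (gcd[m,n]≢0 (k * c) (k * d) (inj₁ (n>0⇒n≢0 0<kc)))
  k≤g : k ≤ g
  k≤g = ∣⇒≤ (gcd-greatest (m∣m*n c) (m∣m*n d))

ceiling-multiple : ∀ x v → 0 < x → 0 < v → ∃₂ λ k D → 0 < k × k * v ≡ x + D × D < v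
ceiling-multiple (suc x') v@(suc v') _ _ =
  suc q , v' ∸ m , z<s , kv≡x+D , s≤s (m∸n≤m v' m)
  where
  q m : ℕ
  q = x' / v
  m = x' % v
  m≤v' : m ≤ v'
  m≤v' = ≤-pred (m%n<n x' v)
  kv≡x+D : suc q * v ≡ suc x' + (v' ∸ m)
  kv≡x+D = begin
    suc (v' + q * v)               ≡⟨ cong (λ t → suc (t + q * v)) (m+[n∸m]≡n m≤v') ⟨
    suc (m + (v' ∸ m) + q * v)     ≡⟨ cong suc (swap-last m (v' ∸ m) (q * v)) ⟩
    suc (m + q * v + (v' ∸ m))     ≡⟨ cong (λ t → suc (t + (v' ∸ m))) (m≡m%n+[m/n]*n x' v) ⟨
    suc x' + (v' ∸ m)              ∎
    where
    open ≡-Reasoning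
    swap-last : ∀ m n o → m + n + o ≡ m + o + n
    swap-last = solve-∀

∣y-ku∣*v≤∣xu-yv∣+Du : ∀ x y u v k D → k * v ≡ x + D →
                       ∣ y - k * u ∣ * v ≤ ∣ x * u - y * v ∣ + D * u
∣y-ku∣*v≤∣xu-yv∣+Du x y u v k D kv≡x+D = begin
  ∣ y - k * u ∣ * v                          ≡⟨ *-distribʳ-∣-∣ v y (k * u) ⟩
  ∣ y * v - k * u * v ∣                      ≡⟨ cong (∣_-_∣ (y * v)) kuv≡xu+Du ⟩
  ∣ y * v - x * u + D * u ∣                  ≤⟨ ∣-∣-triangle (y * v) (x * u) (x * u + D * u) ⟩
  ∣ y * v - x * u ∣ + ∣ x * u - x * u + D * u ∣ ≡⟨ cong₂ _+_ (∣-∣-comm (y * v) (x * u)) (∣m-m+n∣≡n (x * u) (D * u)) ⟩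
  ∣ x * u - y * v ∣ + D * u                  ∎
  where
  open ≤-Reasoning
  swap-last : ∀ m n o → m * n * o ≡ m * o * n
  swap-last = solve-∀
  kuv≡xu+Du : k * u * v ≡ x * u + D * u
  kuv≡xu+Du = begin-equality
    k * u * v   ≡⟨ swap-last k u v ⟩
    k * v * u   ≡⟨ cong (_* u) kv≡x+D ⟩
    (x + D) * u ≡⟨ *-distribʳ-+ u x D ⟩
    x * u + D * u ∎

*-suc-dominates : ∀ a S D → 0 < a → 0 < S → D * S + a ≤ a * S * suc D
*-suc-dominates a S D 0<a 0<S = begin
  D * S + a           ≤⟨ +-mono-≤ (m≤n*m (D * S) a {{>-nonZero 0<a}}) (m≤m*n a S {{>-nonZero 0<S}}) ⟩
  a * (D * S) + a * S ≡⟨ rearrange a S D ⟩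
  a * S * suc D       ∎
  where
  open ≤-Reasoning
  rearrange : ∀ a S D → a * (D * S) + a * S ≡ a * S * suc D
  rearrange = solve-∀

offsets-bound : ∀ a u v D e → 0 < a → 0 < u → D < v → e * v ≤ a + D * u → D + e ≤ a * (u + v)
offsets-bound a u v D e 0<a 0<u D<v ev≤a+Du =
  *-cancelʳ-≤ (D + e) (a * (u + v)) v {{>-nonZero (<-≤-trans z<s D<v)}} (begin
  (D + e) * v         ≡⟨ *-distribʳ-+ v D e ⟩
  D * v + e * v       ≤⟨ +-monoʳ-≤ (D * v) ev≤a+Du ⟩
  D * v + (a + D * u) ≡⟨ regroup D a u v ⟩
  D * (u + v) + a     ≤⟨ *-suc-dominates a (u + v) D 0<a (<-≤-trans 0<u (m≤m+n u v)) ⟩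
  a * (u + v) * suc D ≤⟨ *-monoʳ-≤ (a * (u + v)) D<v ⟩
  a * (u + v) * v     ∎)
  where
  open ≤-Reasoning
  regroup : ∀ D a u v → D * v + (a + D * u) ≡ D * (u + v) + a
  regroup = solve-∀

mainTheorem14 : (x y u v a : ℕ) → 0 < x → 0 < y → 0 < u → 0 < v → 0 < a →
    ∣ x * u - y * v ∣ ≤ a → DistT0≤ (u ⊔ v) x y (a * (u + v))
mainTheorem14 x y u v a 0<x _ 0<u 0<v 0<a h
  with ceiling-multiple x v 0<x 0<v
... | k , D , 0<k , kv≡x+D , D<v =
  k * v , k * u , *-∈T0 k v u 0<k 0<v 0<u (≤-reflexive (⊔-comm v u)) , distance
  where
  distance : ∣ x - k * v ∣ + ∣ y - k * u ∣ ≤ a * (u + v)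
  distance rewrite kv≡x+D | ∣m-m+n∣≡n x D =
    offsets-bound a u v D ∣ y - k * u ∣ 0<a 0<u D<v
      (≤-trans (∣y-ku∣*v≤∣xu-yv∣+Du x y u v k D kv≡x+D) (+-monoˡ-≤ (D * u) h))
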